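{- Let $\mathcal{T}$ be the set of finite rooted trees (up to label-preserving isomorphism) carrying a valid label assignment whose labels are prime numbers. For a vertex $v$ of such a tree define recursively $E(v)=\prod_{c} \ell(c)^{E(c)}$, the product over the children $c$ of $v$, where $\ell(c)$ is the label of $c$ (the empty product being $1$), and define the evaluation of a tree $T$ as $E(\text{root of }T)$. Then the evaluation map $\mathcal{T}\to\mathbb{N}=\{1,2,3,\dots\}$ is a bijection (with the single-vertex tree mapping to $1$).
   Context: A rooted tree is a tree with a distinguished vertex, the root; children of a vertex $v$ are the neighbors of $v$ farther from the root, and siblings are vertices with the same parent. A label assignment is valid if the root is unlabeled, every non-root vertex has a label, and no two siblings have the same label. Children are unordered, so trees are considered up to isomorphism of rooted trees preserving labels. -}

module Defs where

open import Data.Nat using (ℕ; _*_; _^_)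
open import Data.Nat.Primality using (Prime)
open import Data.Product using (_×_; _,_; proj₁; Σ)
open import Data.Unit using (⊤)
open import Data.List using (List; []; _∷_; map)
open import Data.List.Relation.Unary.Unique.Propositional using (Unique)
open import Data.List.Relation.Binary.Permutation.Propositional using (_↭_)
open import Data.List.Relation.Binary.Pointwise using (Pointwise)
open import Relation.Binary.PropositionalEquality using (_≡_)

-- A finite rooted tree: the root with a finite list of children, each child
-- given by its label together with the subtree hanging from it.
-- The list order is irrelevant: trees are compared up to the isomorphism _≅_ below.
data RTree : Set where
  node : List (ℕ × RTree) → RTree

children : RTree → List (ℕ × RTree)
children (node cs) = cs

mutual
  ValidPrime : RTree → Set
  ValidPrime (node cs) = Unique (map proj₁ cs) × ValidPrimeChildren cs

  ValidPrimeChildren : List (ℕ × RTree) → Set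
  ValidPrimeChildren [] = ⊤
  ValidPrimeChildren ((l , t) ∷ cs) = Prime l × ValidPrime t × ValidPrimeChildren cs

data _≅_ : RTree → RTree → Set where
  node≅ : ∀ {xs ys} (zs : List (ℕ × RTree)) → xs ↭ zs →
          Pointwise (λ a b → (proj₁ a ≡ proj₁ b) × (Data.Product.proj₂ a ≅ Data.Product.proj₂ b)) zs ys →
          node xs ≅ node ys

mutual
  eval : RTree → ℕ
  eval (node cs) = evalChildren cs

  evalChildren : List (ℕ × RTree) → ℕ
  evalChildren [] = 1
  evalChildren ((l , t) ∷ cs) = (l ^ eval t) * evalChildren cs

singleVertex : RTree
singleVertex = node []

module Submission where

open import Defs
open import Data.Nat using (ℕ; _≤_)
open import Data.Product using (_×_; Σ)
open import Relation.Binary.PropositionalEquality using (_≡_)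

open import Data.Nat using (zero; suc; _*_; _^_; _<_; z≤n; s≤s; NonZero; >-nonZero; nonTrivial⇒≢1; nonTrivial⇒n>1)
open import Data.Nat.Properties
open import Data.Nat.Divisibility
open import Data.Nat.Primality using (Prime; euclidsLemma; prime⇒irreducible; prime⇒nonZero; prime⇒nonTrivial)
open import Data.Nat.Primality.Factorisation using (factorise)
open import Data.Nat.Induction using (<-rec)
open import Data.Nat.ListAction using (product)
open import Data.Nat.ListAction.Properties using (product-↭)
open import Data.Product using (_,_; proj₁; proj₂; ∃)
open import Data.Sum using (inj₁; inj₂)
open import Data.Unit using (tt)
open import Data.Empty using (⊥-elim)
open import Data.List using (List; []; _∷_; map)
open import Data.List.Relation.Unary.All as All using (All; []; _∷_)
open import Data.List.Relation.Unary.Any using (here; there)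
open import Data.List.Relation.Unary.AllPairs using ([]; _∷_)
open import Data.List.Relation.Unary.Unique.Propositional using (Unique)
open import Data.List.Relation.Binary.Permutation.Propositional using (_↭_; refl; prep; swap; trans; ↭-sym; ↭⇒↭ₛ)
open import Data.List.Relation.Binary.Permutation.Propositional.Properties using (map⁺)
open import Data.List.Relation.Binary.Pointwise using (Pointwise; []; _∷_)
open import Data.List.Membership.Propositional using (_∈_)
open import Relation.Binary.PropositionalEquality using (refl; sym; cong; cong₂; subst; _≢_; setoid; module ≡-Reasoning) renaming (trans to ≡-trans)
open import Relation.Nullary using (¬_; yes; no)
import Data.List.Relation.Binary.Permutation.Setoid.Properties as SetoidPermutation

-- The value of a vertex with children labelled p₁,…,pᵣ (distinct
-- primes) is E = p₁^{E(c₁)} ⋯ pᵣ^{E(cᵣ)}, and every E(cᵢ) ≥ 1.  So the primes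
-- dividing E are exactly the labels of the children, and the exponent of pᵢ
-- in E is E(cᵢ): the children of the root are read off from the prime
-- factorisation of E.  This gives both directions by recursion.
--   * Injectivity: match the first child (p, t) of one tree with the child
--     (p, u) of the other carrying the same label; cancelling the p-part of
--     the two products gives E(t) = E(u) and equal values of the remaining
--     children, so induction yields t ≅ u and isomorphic remaining trees.
--   * Surjectivity: for n ≥ 2 pick a prime p ∣ n, write n = p^k · m with
--     p ∤ m; as k, m < n they are values of trees T_k, T_m, and attaching a
--     p-labelled child T_k to the root of T_m yields a tree of value n.

prime∤1 : ∀ {p} → Prime p → ¬ p ∣ 1
prime∤1 pp p∣1 = nonTrivial⇒≢1 {{prime⇒nonTrivial pp}} (∣1⇒≡1 p∣1)

prime>1 : ∀ {p} → Prime p → 1 < p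
prime>1 {p} pp = nonTrivial⇒n>1 p {{prime⇒nonTrivial pp}}

prime∣prime^⇒≡ : ∀ {p q} → Prime p → Prime q → ∀ k → p ∣ q ^ k → p ≡ q
prime∣prime^⇒≡ pp pq zero p∣1 = ⊥-elim (prime∤1 pp p∣1)
prime∣prime^⇒≡ {q = q} pp pq (suc k) p∣q^k+1 with euclidsLemma q (q ^ k) pp p∣q^k+1
... | inj₂ p∣q^k = prime∣prime^⇒≡ pp pq k p∣q^k
... | inj₁ p∣q with prime⇒irreducible pq p∣q
...   | inj₁ refl = ⊥-elim (prime∤1 pp ∣-refl)
...   | inj₂ p≡q = p≡q

primeDivisor : ∀ n → 1 < n → ∃ λ p → Prime p × p ∣ n
primeDivisor (suc zero) (s≤s ())
primeDivisor n@(suc (suc _)) _ with factorise n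
... | record { factors = [] ; isFactorisation = () }
... | record { factors = p ∷ _ ; isFactorisation = n≡∏ ; factorsPrime = pp ∷ _ } =
  p , pp , subst (p ∣_) (sym n≡∏) (m∣m*n _)

n<p^n : ∀ {p} → 1 < p → ∀ n → n < p ^ n
n<p^n 1<p zero = s≤s z≤n
n<p^n {p} 1<p (suc n) = ≤-<-trans (n<p^n 1<p n) (^-monoʳ-< p 1<p (n<1+n n))

p-adic-parts< : ∀ {p} → 1 < p → ∀ {k m} → 1 ≤ k → 1 ≤ m → k < p ^ k * m × m < p ^ k * m
p-adic-parts< {p} 1<p {k} {m} 1≤k 1≤m =
  <-≤-trans (n<p^n 1<p k) (m≤m*n (p ^ k) m {{>-nonZero 1≤m}}) ,
  subst (m <_) (*-comm m (p ^ k)) (m<m*n m (p ^ k) {{>-nonZero 1≤m}} (^-monoʳ-< p 1<p 1≤k))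

p-adic : ∀ {p} → 1 < p → ∀ n → 1 ≤ n → ∃ λ k → ∃ λ m → n ≡ p ^ k * m × ¬ p ∣ m
p-adic {p} 1<p = <-rec _ step
  where
  step : ∀ n → (∀ {q} → q < n → 1 ≤ q → ∃ λ k → ∃ λ m → q ≡ p ^ k * m × ¬ p ∣ m) →
         1 ≤ n → ∃ λ k → ∃ λ m → n ≡ p ^ k * m × ¬ p ∣ m
  step n rec 1≤n with p ∣? n
  ... | no p∤n = 0 , n , sym (*-identityˡ n) , p∤n
  ... | yes (divides zero refl) with () ← 1≤n
  ... | yes (divides q@(suc _) n≡q*p) with rec q<n (s≤s z≤n)
    where q<n = subst (q <_) (sym n≡q*p) (m<m*n q p 1<p)
  ...   | k , m , q≡p^k*m , p∤m = suc k , m , n≡p^[k+1]*m , p∤m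
    where
    open ≡-Reasoning
    n≡p^[k+1]*m : n ≡ p ^ suc k * m
    n≡p^[k+1]*m = begin
      n               ≡⟨ n≡q*p ⟩
      q * p           ≡⟨ *-comm q p ⟩
      p * q           ≡⟨ cong (p *_) q≡p^k*m ⟩
      p * (p ^ k * m) ≡⟨ *-assoc p (p ^ k) m ⟨
      p ^ suc k * m   ∎

p-adic-unique : ∀ {p} .{{_ : NonZero p}} a b {A B} →
                p ^ a * A ≡ p ^ b * B → ¬ p ∣ A → ¬ p ∣ B → a ≡ b × A ≡ B
p-adic-unique zero zero {A} {B} e _ _ = refl , ≡-trans (sym (*-identityˡ A)) (≡-trans e (*-identityˡ B))
p-adic-unique {p} zero (suc b) {A} {B} e p∤A _ =
  ⊥-elim (p∤A (subst (p ∣_) (≡-trans (sym e) (*-identityˡ A)) (∣m⇒∣m*n B (m∣m*n (p ^ b)))))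
p-adic-unique {p} (suc a) zero {A} {B} e _ p∤B =
  ⊥-elim (p∤B (subst (p ∣_) (≡-trans e (*-identityˡ B)) (∣m⇒∣m*n A (m∣m*n (p ^ a)))))
p-adic-unique {p} (suc a) (suc b) {A} {B} e p∤A p∤B
  with p-adic-unique a b (*-cancelˡ-≡ (p ^ a * A) (p ^ b * B) p p*[p^a*A]≡p*[p^b*B]) p∤A p∤B
  where
  open ≡-Reasoning
  p*[p^a*A]≡p*[p^b*B] : p * (p ^ a * A) ≡ p * (p ^ b * B)
  p*[p^a*A]≡p*[p^b*B] = begin
    p * (p ^ a * A) ≡⟨ *-assoc p (p ^ a) A ⟨
    p ^ suc a * A   ≡⟨ e ⟩
    p ^ suc b * B   ≡⟨ *-assoc p (p ^ b) B ⟩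
    p * (p ^ b * B) ∎
... | a≡b , A≡B = cong suc a≡b , A≡B

Unique-resp-↭ : ∀ {xs ys : List ℕ} → xs ↭ ys → Unique xs → Unique ys
Unique-resp-↭ π = SetoidPermutation.Unique-resp-↭ (setoid ℕ) (↭⇒↭ₛ π)

Pointwise-↭ : ∀ {A B : Set} {R : A → B → Set} {xs ys ys′} →
              Pointwise R xs ys → ys ↭ ys′ → ∃ λ xs′ → xs ↭ xs′ × Pointwise R xs′ ys′
Pointwise-↭ rs refl = _ , refl , rs
Pointwise-↭ (r ∷ rs) (prep _ π) with Pointwise-↭ rs π
... | _ , ρ , rs′ = _ , prep _ ρ , r ∷ rs′
Pointwise-↭ (r₁ ∷ r₂ ∷ rs) (swap _ _ π) with Pointwise-↭ rs π
... | _ , ρ , rs′ = _ , swap _ _ ρ , r₂ ∷ r₁ ∷ rs′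
Pointwise-↭ rs (trans π₁ π₂) with Pointwise-↭ rs π₁
... | _ , ρ₁ , rs₁ with Pointwise-↭ rs₁ π₂
...   | _ , ρ₂ , rs₂ = _ , trans ρ₁ ρ₂ , rs₂

labels : List (ℕ × RTree) → List ℕ
labels = map proj₁

factor : ℕ × RTree → ℕ
factor (l , t) = l ^ eval t

evalChildren≡product : ∀ cs → evalChildren cs ≡ product (map factor cs)
evalChildren≡product [] = refl
evalChildren≡product (c ∷ cs) = cong (factor c *_) (evalChildren≡product cs)

evalChildren-↭ : ∀ {cs ds} → cs ↭ ds → evalChildren cs ≡ evalChildren ds
evalChildren-↭ {cs} {ds} π = begin
  evalChildren cs           ≡⟨ evalChildren≡product cs ⟩
  product (map factor cs)   ≡⟨ product-↭ (map⁺ factor π) ⟩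
  product (map factor ds)   ≡⟨ evalChildren≡product ds ⟨
  evalChildren ds           ∎
  where open ≡-Reasoning

mutual
  eval-resp-≅ : ∀ {S T} → S ≅ T → eval S ≡ eval T
  eval-resp-≅ (node≅ _ π rs) = ≡-trans (evalChildren-↭ π) (evalChildren-resp-≅ rs)

  evalChildren-resp-≅ : ∀ {cs ds} →
    Pointwise (λ c d → proj₁ c ≡ proj₁ d × proj₂ c ≅ proj₂ d) cs ds →
    evalChildren cs ≡ evalChildren ds
  evalChildren-resp-≅ [] = refl
  evalChildren-resp-≅ ((l≡l′ , t≅t′) ∷ rs) =
    cong₂ _*_ (cong₂ _^_ l≡l′ (eval-resp-≅ t≅t′)) (evalChildren-resp-≅ rs)

mutual
  eval-positive : ∀ T → ValidPrime T → 1 ≤ eval T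
  eval-positive (node cs) (_ , vcs) = evalChildren-positive cs vcs

  evalChildren-positive : ∀ cs → ValidPrimeChildren cs → 1 ≤ evalChildren cs
  evalChildren-positive [] _ = s≤s z≤n
  evalChildren-positive ((l , t) ∷ cs) (pl , _ , vcs) =
    *-mono-≤ (m^n>0 l {{prime⇒nonZero pl}} (eval t)) (evalChildren-positive cs vcs)

ValidPrimeChildren-↭ : ∀ {cs ds} → cs ↭ ds → ValidPrimeChildren cs → ValidPrimeChildren ds
ValidPrimeChildren-↭ refl v = v
ValidPrimeChildren-↭ (prep _ π) (pl , vt , v) = pl , vt , ValidPrimeChildren-↭ π v
ValidPrimeChildren-↭ (swap _ _ π) (pl , vt , pl′ , vt′ , v) = pl′ , vt′ , pl , vt , ValidPrimeChildren-↭ π v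
ValidPrimeChildren-↭ (trans π₁ π₂) v = ValidPrimeChildren-↭ π₂ (ValidPrimeChildren-↭ π₁ v)

ValidPrime-↭ : ∀ {cs ds} → cs ↭ ds → ValidPrime (node cs) → ValidPrime (node ds)
ValidPrime-↭ π (u , v) = Unique-resp-↭ (map⁺ proj₁ π) u , ValidPrimeChildren-↭ π v

-- The primes dividing the value of a vertex are exactly the labels of its
-- children: every label of a child divides the value (its exponent E(c) is ≥ 1).
label∣evalChildren : ∀ {l} cs → l ∈ labels cs → ValidPrimeChildren cs → l ∣ evalChildren cs
label∣evalChildren ((l , t) ∷ cs) (here refl) (_ , vt , _) with eval t | eval-positive t vt
... | suc k | _ = ∣m⇒∣m*n (evalChildren cs) (m∣m*n (l ^ k))
label∣evalChildren ((l , t) ∷ cs) (there l∈cs) (_ , _ , vcs) =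
  ∣n⇒∣m*n (l ^ eval t) (label∣evalChildren cs l∈cs vcs)

nonLabel∤evalChildren : ∀ {p} → Prime p → ∀ cs → All (p ≢_) (labels cs) →
                        ValidPrimeChildren cs → ¬ p ∣ evalChildren cs
nonLabel∤evalChildren pp [] _ _ p∣1 = prime∤1 pp p∣1
nonLabel∤evalChildren pp ((l , t) ∷ cs) (p≢l ∷ p∉cs) (pl , _ , vcs) p∣E
  with euclidsLemma (l ^ eval t) (evalChildren cs) pp p∣E
... | inj₁ p∣l^E = p≢l (prime∣prime^⇒≡ pp pl (eval t) p∣l^E)
... | inj₂ p∣Ecs = nonLabel∤evalChildren pp cs p∉cs vcs p∣Ecs

prime∣evalChildren⇒child : ∀ {p} → Prime p → ∀ cs → ValidPrimeChildren cs → p ∣ evalChildren cs →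
                            ∃ λ u → ∃ λ cs′ → cs ↭ (p , u) ∷ cs′
prime∣evalChildren⇒child pp [] _ p∣1 = ⊥-elim (prime∤1 pp p∣1)
prime∣evalChildren⇒child {p} pp ((l , t) ∷ cs) (pl , _ , vcs) p∣E
  with euclidsLemma (l ^ eval t) (evalChildren cs) pp p∣E
... | inj₁ p∣l^E with refl ← prime∣prime^⇒≡ pp pl (eval t) p∣l^E = t , cs , refl
... | inj₂ p∣Ecs with prime∣evalChildren⇒child pp cs vcs p∣Ecs
...   | u , cs′ , π = u , (l , t) ∷ cs′ , trans (prep (l , t) π) (swap (l , t) (p , u) refl)

≅-cons : ∀ {l t u cs ds} → t ≅ u → node cs ≅ node ds → node ((l , t) ∷ cs) ≅ node ((l , u) ∷ ds)
≅-cons t≅u (node≅ zs π rs) = node≅ (_ ∷ zs) (prep _ π) ((refl , t≅u) ∷ rs)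

≅-↭ʳ : ∀ {cs ds ds′} → node cs ≅ node ds → ds ↭ ds′ → node cs ≅ node ds′
≅-↭ʳ (node≅ _ π rs) ρ with Pointwise-↭ rs ρ
... | zs′ , ρ′ , rs′ = node≅ zs′ (trans π ρ′) rs′

mutual
  eval-injective : ∀ S T → ValidPrime S → ValidPrime T → eval S ≡ eval T → S ≅ T
  eval-injective (node cs) (node ds) = evalChildren-injective cs ds

  -- Induction on the children of the left tree: its first child (p, t) is
  -- matched with the child (p, u) of the right tree, and cancelling the
  -- p-parts of the two values compares E(t) with E(u) and the rest with the rest.
  evalChildren-injective : ∀ cs ds → ValidPrime (node cs) → ValidPrime (node ds) →
                           evalChildren cs ≡ evalChildren ds → node cs ≅ node ds
  evalChildren-injective [] [] _ _ _ = node≅ [] refl []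
  evalChildren-injective [] ds@((l , _) ∷ _) _ (_ , vds@(pl , _)) 1≡E =
    ⊥-elim (prime∤1 pl (subst (l ∣_) (sym 1≡E) (label∣evalChildren ds (here refl) vds)))
  evalChildren-injective cs₀@((p , t) ∷ cs) ds (p∉cs ∷ ucs , vcs₀@(pp , vt , vcs)) (uds , vds) E≡E
    with prime∣evalChildren⇒child pp ds vds p∣Eds
    where
    p∣Eds : p ∣ evalChildren ds
    p∣Eds = subst (p ∣_) E≡E (label∣evalChildren cs₀ (here refl) vcs₀)
  ... | u , ds′ , π with ValidPrime-↭ π (uds , vds)
  ...   | p∉ds′ ∷ uds′ , _ , vu , vds′
    with p-adic-unique {{prime⇒nonZero pp}} (eval t) (eval u) (≡-trans E≡E (evalChildren-↭ π))
           (nonLabel∤evalChildren pp cs p∉cs vcs) (nonLabel∤evalChildren pp ds′ p∉ds′ vds′)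
  ...     | Et≡Eu , Ecs≡Eds′ = ≅-↭ʳ (≅-cons t≅u cs≅ds′) (↭-sym π)
    where
    t≅u : t ≅ u
    t≅u = eval-injective t u vt vu Et≡Eu
    cs≅ds′ : node cs ≅ node ds′
    cs≅ds′ = evalChildren-injective cs ds′ (ucs , vcs) (uds′ , vds′) Ecs≡Eds′

attach-valid : ∀ {p} T cs → Prime p → ValidPrime T → ValidPrime (node cs) →
               ¬ p ∣ evalChildren cs → ValidPrime (node ((p , T) ∷ cs))
attach-valid {p} T cs pp vT (ucs , vcs) p∤Ecs = p∉cs ∷ ucs , pp , vT , vcs
  where
  p∉cs : All (p ≢_) (labels cs)
  p∉cs = All.tabulate λ l∈cs p≡l → p∤Ecs (subst (_∣ evalChildren cs) (sym p≡l) (label∣evalChildren cs l∈cs vcs))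

eval-surjective : ∀ n → 1 ≤ n → Σ RTree λ T → ValidPrime T × eval T ≡ n
eval-surjective = <-rec _ step
  where
  step : ∀ n → (∀ {m} → m < n → 1 ≤ m → Σ RTree λ T → ValidPrime T × eval T ≡ m) →
         1 ≤ n → Σ RTree λ T → ValidPrime T × eval T ≡ n
  step (suc zero) _ _ = singleVertex , ([] , tt) , refl
  step n@(suc (suc _)) rec 1≤n with primeDivisor n (s≤s (s≤s z≤n))
  ... | p , pp , p∣n with p-adic (prime>1 pp) n 1≤n
  ...   | zero , m , n≡1*m , p∤m = ⊥-elim (p∤m (subst (p ∣_) (≡-trans n≡1*m (*-identityˡ m)) p∣n))
  ...   | suc _ , zero , _ , p∤0 = ⊥-elim (p∤0 (p ∣0))
  ...   | k@(suc _) , m@(suc _) , n≡p^k*m , p∤m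
    with p-adic-parts< (prime>1 pp) (s≤s z≤n) (s≤s z≤n)
  ...     | k<n , m<n
    with rec (subst (k <_) (sym n≡p^k*m) k<n) (s≤s z≤n) | rec (subst (m <_) (sym n≡p^k*m) m<n) (s≤s z≤n)
  ...       | T , vT , ET≡k | node cs , vcs , Ecs≡m =
    node ((p , T) ∷ cs) ,
    attach-valid T cs pp vT vcs (subst (λ x → ¬ p ∣ x) (sym Ecs≡m) p∤m) ,
    ≡-trans (cong₂ (λ e r → p ^ e * r) ET≡k Ecs≡m) (sym n≡p^k*m)

mainTheorem2 :
    (∀ S T → ValidPrime S → ValidPrime T → S ≅ T → eval S ≡ eval T)
    × (∀ T → ValidPrime T → 1 ≤ eval T)
    × (∀ S T → ValidPrime S → ValidPrime T → eval S ≡ eval T → S ≅ T)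
    × (∀ n → 1 ≤ n → Σ RTree (λ T → ValidPrime T × eval T ≡ n))
    × (eval singleVertex ≡ 1)
mainTheorem2 =
  (λ _ _ _ _ → eval-resp-≅) , eval-positive , eval-injective , eval-surjective , refl
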